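{- Let $k\ge5$ be an odd integer and let $N(x,y)$ be a necklace with end vertices $x,y$ whose distance in $N(x,y)$ is $d(x,y)=t\ge\frac{k+1}{2}$. Let $\varphi$ assign to $x$ and $y$ $\frac{k-1}{2}$-element subsets of $\{1,\dots,k\}$. If $$\frac{k-t}{2}-\frac{(-1)^t+1}{4}\le|\varphi(x)\cap\varphi(y)|\le\frac{t-1}{2}-\frac{(-1)^t+1}{4},$$ then $\varphi$ extends to a fractional $(k:\frac{k-1}{2})$-coloring of $N(x,y)$.
   Context: A fractional $(k:\frac{k-1}{2})$-coloring of a graph assigns to each vertex $v$ a $\frac{k-1}{2}$-element subset $\varphi(v)\subseteq\{1,\dots,k\}$ with $\varphi(u)\cap\varphi(v)=\emptyset$ for every edge $uv$. A necklace $N(x,y)$ with end vertices $x,y$ is a graph obtained from a path $x=z_0z_1\cdots z_m=y$ by replacing some of its edges $z_iz_{i+1}$ by a $k$-cycle passing through $z_i$ and $z_{i+1}$ whose remaining vertices are new (distinct replaced edges receive disjoint sets of new vertices). -}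

module Defs where

open import Data.Nat using (ℕ; zero; suc; _+_; _∸_; _≤_)
open import Data.Fin using (Fin; zero; suc; inject₁)
open import Data.Bool using (Bool)
open import Data.Unit using (⊤)
open import Data.Sum using (_⊎_)
open import Data.Product using (_×_)
open import Relation.Binary.PropositionalEquality using (_≡_)
open import Data.Fin.Subset using (Subset; _∩_; ∣_∣) renaming (⊥ to ∅)

record Graph : Set₁ where
  field
    V    : Set
    Edge : V → V → Set

open Graph public

data Walk (G : Graph) : V G → V G → ℕ → Set where
  nil  : ∀ {u} → Walk G u u zero
  cons : ∀ {u v w n} → Edge G u v → Walk G v w n → Walk G u w (suc n)

Dist : (G : Graph) → V G → V G → ℕ → Set
Dist G x y t = Walk G x y t × (∀ n → Walk G x y n → t ≤ n)

IsFracColoring : (G : Graph) (k r : ℕ) → (V G → Subset k) → Set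
IsFracColoring G k r φ =
  (∀ v → ∣ φ v ∣ ≡ r) × (∀ u v → Edge G u v → φ u ∩ φ v ≡ ∅)

-- A segment z_i z_{i+1} of the underlying path is either a plain edge,
-- or is replaced by a k-cycle through z_i and z_{i+1}.  The k-cycle is
-- split by z_i, z_{i+1} into two arcs with p resp. q new internal
-- vertices, p + q = k - 2 (p = 0 means z_i z_{i+1} is an edge of the cycle).
data Seg (k : ℕ) : Set where
  plain : Seg k
  cyc   : (p q : ℕ) → p + q ≡ k ∸ 2 → Seg k

Arc : ∀ {k} → Seg k → Set
Arc plain         = ⊤
Arc (cyc _ _ _)   = Bool

inner : ∀ {k} (s : Seg k) → Arc s → ℕ
inner plain         _          = 0
inner (cyc p q _)   Bool.true  = p
inner (cyc p q _)   Bool.false = q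

-- positions 0 .. n+1 along a path s, f 0, ..., f (n-1), t
arcPos : ∀ {A : Set} {n} → A → A → (Fin n → A) → Fin (suc (suc n)) → A
arcPos s t f zero                   = s
arcPos {n = zero}  s t f (suc zero) = t
arcPos {n = suc n} s t f (suc j)    = arcPos (f zero) t (λ i → f (suc i)) j

module Necklace (k m : ℕ) (segs : Fin m → Seg k) where

  -- vertices: path vertices z_0..z_m, and the new internal arc vertices
  data NV : Set where
    pv : Fin (suc m) → NV
    av : (i : Fin m) (r : Arc (segs i)) → Fin (inner (segs i) r) → NV

  arcV : (i : Fin m) (r : Arc (segs i)) → Fin (suc (suc (inner (segs i) r))) → NV
  arcV i r = arcPos (pv (inject₁ i)) (pv (suc i)) (av i r)

  data Adj : NV → NV → Set where
    arcE : (i : Fin m) (r : Arc (segs i)) (j : Fin (suc (inner (segs i) r))) →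
           Adj (arcV i r (inject₁ j)) (arcV i r (suc j))

  graph : Graph
  graph = record { V = NV ; Edge = λ u v → Adj u v ⊎ Adj v u }

  x : NV
  x = pv zero

  y : NV
  y = pv (Data.Fin.fromℕ m)

module Submission where

-- With k = 2r + 1, a fractional (k : r)-colouring is a homomorphism into the Kneser graph
-- K(2r+1, r).  Two r-sets meeting in s elements are joined there by walks of every even length
-- ≥ 2(r − s) and every odd length ≥ 2s + 1.  A cycle of the necklace has length 2r + 1, so its two
-- arcs between z_i and z_{i+1} have lengths ℓ and 2r + 1 − ℓ, one of each parity, and both are
-- least walk lengths for the same intersection size α_i: any colouring of z_i and z_{i+1} by sets
-- meeting in α_i elements extends along both arcs.  It remains to colour the path z_0 … z_m from
-- A to B with these prescribed intersections.  This is done one vertex at a time: a third r-set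
-- with prescribed intersections with two given ones exists as soon as the three corresponding walk
-- lengths satisfy the triangle inequalities with even perimeter at most 2(2r + 1), and the bounds
-- on |A ∩ B| guarantee that the remaining length of the path can always still be used up.

open import Defs
open import Data.Nat using (ℕ; zero; suc; _+_; _*_; _∸_; _≤_; _<_; z≤n; s≤s; _≤?_; _%_; _/_)
open import Data.Nat.DivMod using (m≡m%n+[m/n]*n; m*n/n≡m)
open import Data.Nat.Properties
open import Data.Fin using (Fin; zero; suc; inject₁; fromℕ)
open import Data.Vec.Functional using (foldr)
open import Data.Fin.Subset using (Subset; _∩_; _∪_; _─_; ∁; ∣_∣; inside; outside) renaming (⊥ to ∅)
open import Data.Fin.Subset.Properties using (∩-comm)
open import Data.Product using (Σ; ∃; _×_; _,_; proj₁; proj₂)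
open import Data.Sum using (_⊎_; inj₁; inj₂)
open import Data.Empty using (⊥; ⊥-elim)
open import Data.Unit using (tt)
open import Data.Bool using (true; false)
open import Data.Integer using (ℤ; +_; -_; _^_)
  renaming (_+_ to _+ℤ_; _-_ to _-ℤ_; _*_ to _*ℤ_; _≤_ to _≤ℤ_)
import Data.Integer.Properties as ℤ
import Data.Integer.Tactic.RingSolver as ℤ-Ring
open import Relation.Nullary using (¬_; yes; no)
open import Relation.Binary.PropositionalEquality
open import Data.Nat.Tactic.RingSolver using (solve; solve-∀)
open import Data.List using ([]; _∷_)

data Parity : ℕ → Set where
  even : ∀ a → Parity (a + a)
  odd  : ∀ a → Parity (suc (a + a))

parity : ∀ n → Parity n
parity zero = even 0
parity (suc n) with parity n
... | even a = odd a
... | odd a  = subst Parity (cong suc (+-suc a a)) (even (suc a))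

Even : ℕ → Set
Even n = ∃ λ q → n ≡ q + q

1+m+m≢n+n : ∀ m n → suc (m + m) ≢ n + n
1+m+m≢n+n zero    zero    ()
1+m+m≢n+n zero    (suc n) eq with trans (suc-injective eq) (+-suc n n)
... | ()
1+m+m≢n+n (suc m) zero    ()
1+m+m≢n+n (suc m) (suc n) eq =
  1+m+m≢n+n m n (suc-injective (trans (cong suc (sym (+-suc m m))) (trans (suc-injective eq) (+-suc n n))))

Even-+ : ∀ {m n} → Even m → Even n → Even (m + n)
Even-+ (a , refl) (b , refl) = a + b , solve (a ∷ b ∷ [])

Even-cancelˡ : ∀ {m n} → Even m → Even (m + n) → Even n
Even-cancelˡ {n = n} (a , refl) (q , eq) with parity n
... | even b = b , refl
... | odd b  = ⊥-elim (1+m+m≢n+n (a + b) q (trans (regroup a b) eq))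
  where
  regroup : ∀ a b → suc ((a + b) + (a + b)) ≡ a + a + suc (b + b)
  regroup = solve-∀

m+m≤1+n+n⇒m≤n : ∀ {m n} → m + m ≤ suc (n + n) → m ≤ n
m+m≤1+n+n⇒m≤n {zero}          _       = z≤n
m+m≤1+n+n⇒m≤n {suc m} {zero}  (s≤s p) rewrite +-suc m m with p
... | ()
m+m≤1+n+n⇒m≤n {suc m} {suc n} (s≤s p) rewrite +-suc m m | +-suc n n = s≤s (m+m≤1+n+n⇒m≤n (≤-pred p))

m+m≤n+n⇒m≤n : ∀ {m n} → m + m ≤ n + n → m ≤ n
m+m≤n+n⇒m≤n p = m+m≤1+n+n⇒m≤n (m≤n⇒m≤1+n p)

¬Even-1+n+n : ∀ n → ¬ Even (suc (n + n))
¬Even-1+n+n n (q , eq) = 1+m+m≢n+n n q eq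

m+m≤n+n+o+o⇒m≤n+o : ∀ {m n o} → m + m ≤ n + n + (o + o) → m ≤ n + o
m+m≤n+n+o+o⇒m≤n+o {m} {n} {o} p = m+m≤n+n⇒m≤n (subst (m + m ≤_) (regroup n o) p)
  where
  regroup : ∀ n o → n + n + (o + o) ≡ (n + o) + (n + o)
  regroup = solve-∀

1+m+m≤n+n⇒m<n : ∀ {m n} → suc (m + m) ≤ n + n → m < n
1+m+m≤n+n⇒m<n {m} {n} p =
  m+m≤n+n⇒m≤n (subst (_≤ n + n) (cong suc (sym (+-suc m m))) (≤∧≢⇒< p (1+m+m≢n+n m n)))

halve : ∀ n → ∃ λ a → ∃ λ ε → ε ≤ 1 × a + a + ε ≡ n
halve n with parity n
... | even a = a , 0 , z≤n , +-identityʳ (a + a)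
... | odd a  = a , 1 , ≤-refl , +-comm (a + a) 1

linear-≤ : ∀ {L R SL SR} N → SL ≤ SR → R + SL ≡ L + SR + N → L ≤ R
linear-≤ {L} {R} {SL} {SR} N SL≤SR eq = +-cancelʳ-≤ SR L R (begin
  L + SR      ≤⟨ m≤m+n (L + SR) N ⟩
  L + SR + N  ≡⟨ sym eq ⟩
  R + SL      ≤⟨ +-monoʳ-≤ R SL≤SR ⟩
  R + SR      ∎)
  where open ≤-Reasoning

-- Vector patterns live in this module; elsewhere _∷_ is the list constructor taken by solve.
module SubsetCounting where

  open import Data.Vec using (Vec; []; _∷_)

  ∣p∣≡∣p∩q∣+∣p─q∣ : ∀ {n} (p q : Subset n) → ∣ p ∣ ≡ ∣ p ∩ q ∣ + ∣ p ─ q ∣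
  ∣p∣≡∣p∩q∣+∣p─q∣ []            []            = refl
  ∣p∣≡∣p∩q∣+∣p─q∣ (inside  ∷ p) (inside  ∷ q) = cong suc (∣p∣≡∣p∩q∣+∣p─q∣ p q)
  ∣p∣≡∣p∩q∣+∣p─q∣ (inside  ∷ p) (outside ∷ q) =
    trans (cong suc (∣p∣≡∣p∩q∣+∣p─q∣ p q)) (sym (+-suc _ _))
  ∣p∣≡∣p∩q∣+∣p─q∣ (outside ∷ p) (inside  ∷ q) = ∣p∣≡∣p∩q∣+∣p─q∣ p q
  ∣p∣≡∣p∩q∣+∣p─q∣ (outside ∷ p) (outside ∷ q) = ∣p∣≡∣p∩q∣+∣p─q∣ p q

  n≡∣p∣+∣q─p∣+∣∁p∪q∣ : ∀ {n} (p q : Subset n) → n ≡ ∣ p ∣ + ∣ q ─ p ∣ + ∣ ∁ (p ∪ q) ∣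
  n≡∣p∣+∣q─p∣+∣∁p∪q∣ []            []            = refl
  n≡∣p∣+∣q─p∣+∣∁p∪q∣ (inside  ∷ p) (inside  ∷ q) = cong suc (n≡∣p∣+∣q─p∣+∣∁p∪q∣ p q)
  n≡∣p∣+∣q─p∣+∣∁p∪q∣ (inside  ∷ p) (outside ∷ q) = cong suc (n≡∣p∣+∣q─p∣+∣∁p∪q∣ p q)
  n≡∣p∣+∣q─p∣+∣∁p∪q∣ (outside ∷ p) (inside  ∷ q) =
    trans (cong suc (n≡∣p∣+∣q─p∣+∣∁p∪q∣ p q)) (cong (_+ ∣ ∁ (p ∪ q) ∣) (sym (+-suc ∣ p ∣ _)))
  n≡∣p∣+∣q─p∣+∣∁p∪q∣ (outside ∷ p) (outside ∷ q) =
    trans (cong suc (n≡∣p∣+∣q─p∣+∣∁p∪q∣ p q)) (sym (+-suc _ _))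

  ∣p∣≡0⇒p≡∅ : ∀ {n} (p : Subset n) → ∣ p ∣ ≡ 0 → p ≡ ∅
  ∣p∣≡0⇒p≡∅ []            _  = refl
  ∣p∣≡0⇒p≡∅ (outside ∷ p) eq = cong (outside ∷_) (∣p∣≡0⇒p≡∅ p eq)

  ∣p─q∣≡0⇒∣q─p∣≡0⇒p≡q : ∀ {n} (p q : Subset n) → ∣ p ─ q ∣ ≡ 0 → ∣ q ─ p ∣ ≡ 0 → p ≡ q
  ∣p─q∣≡0⇒∣q─p∣≡0⇒p≡q []            []            _  _  = refl
  ∣p─q∣≡0⇒∣q─p∣≡0⇒p≡q (inside  ∷ p) (inside  ∷ q) e₁ e₂ = cong (inside ∷_) (∣p─q∣≡0⇒∣q─p∣≡0⇒p≡q p q e₁ e₂)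
  ∣p─q∣≡0⇒∣q─p∣≡0⇒p≡q (outside ∷ p) (outside ∷ q) e₁ e₂ = cong (outside ∷_) (∣p─q∣≡0⇒∣q─p∣≡0⇒p≡q p q e₁ e₂)

  -- w takes a, b, c, d elements from the four cells p ∩ q, p ─ q, q ─ p, ∁ (p ∪ q).
  choose : ∀ {n} (p q : Subset n) {a b c d} →
    a ≤ ∣ p ∩ q ∣ → b ≤ ∣ p ─ q ∣ → c ≤ ∣ q ─ p ∣ → d ≤ ∣ ∁ (p ∪ q) ∣ →
    ∃ λ w → ∣ w ∣ ≡ a + b + c + d × ∣ p ∩ w ∣ ≡ a + b × ∣ w ∩ q ∣ ≡ a + c
  choose [] [] z≤n z≤n z≤n z≤n = [] , refl , refl , refl
  choose (inside ∷ p) (inside ∷ q) {zero} _ pb pc pd with choose p q z≤n pb pc pd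
  ... | w , e₁ , e₂ , e₃ = outside ∷ w , e₁ , e₂ , e₃
  choose (inside ∷ p) (inside ∷ q) {suc a} (s≤s pa) pb pc pd with choose p q pa pb pc pd
  ... | w , e₁ , e₂ , e₃ = inside ∷ w , cong suc e₁ , cong suc e₂ , cong suc e₃
  choose (inside ∷ p) (outside ∷ q) {b = zero} pa _ pc pd with choose p q pa z≤n pc pd
  ... | w , e₁ , e₂ , e₃ = outside ∷ w , e₁ , e₂ , e₃
  choose (inside ∷ p) (outside ∷ q) {a} {suc b} {c} {d} pa (s≤s pb) pc pd with choose p q pa pb pc pd
  ... | w , e₁ , e₂ , e₃ = inside ∷ w ,
    trans (cong suc e₁) (cong (λ x → x + c + d) (sym (+-suc a b))) , trans (cong suc e₂) (sym (+-suc a b)) , e₃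
  choose (outside ∷ p) (inside ∷ q) {c = zero} pa pb _ pd with choose p q pa pb z≤n pd
  ... | w , e₁ , e₂ , e₃ = outside ∷ w , e₁ , e₂ , e₃
  choose (outside ∷ p) (inside ∷ q) {a} {b} {suc c} {d} pa pb (s≤s pc) pd with choose p q pa pb pc pd
  ... | w , e₁ , e₂ , e₃ = inside ∷ w ,
    trans (cong suc e₁) (cong (_+ d) (sym (+-suc (a + b) c))) , e₂ , trans (cong suc e₃) (sym (+-suc a c))
  choose (outside ∷ p) (outside ∷ q) {d = zero} pa pb pc _ with choose p q pa pb pc z≤n
  ... | w , e₁ , e₂ , e₃ = outside ∷ w , e₁ , e₂ , e₃
  choose (outside ∷ p) (outside ∷ q) {a} {b} {c} {suc d} pa pb pc (s≤s pd) with choose p q pa pb pc pd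
  ... | w , e₁ , e₂ , e₃ = inside ∷ w , trans (cong suc e₁) (sym (+-suc (a + b + c) d)) , e₂ , e₃

  neighbour : ∀ {n} (p q : Subset n) {b d} → b ≤ ∣ q ─ p ∣ → d ≤ ∣ ∁ (p ∪ q) ∣ →
    ∃ λ w → p ∩ w ≡ ∅ × ∣ w ∣ ≡ b + d × ∣ w ∩ q ∣ ≡ b
  neighbour p q pb pd with choose p q z≤n z≤n pb pd
  ... | w , ∣w∣ , ∣p∩w∣ , ∣w∩q∣ = w , ∣p∣≡0⇒p≡∅ (p ∩ w) ∣p∩w∣ , ∣w∣ , ∣w∩q∣

open SubsetCounting

module RSets {r s} (A B : Subset (suc (r + r)))
  (∣A∣≡r : ∣ A ∣ ≡ r) (∣B∣≡r : ∣ B ∣ ≡ r) (∣A∩B∣≡s : ∣ A ∩ B ∣ ≡ s) where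

  s+∣A─B∣≡r : s + ∣ A ─ B ∣ ≡ r
  s+∣A─B∣≡r = trans (cong (_+ ∣ A ─ B ∣) (sym ∣A∩B∣≡s)) (trans (sym (∣p∣≡∣p∩q∣+∣p─q∣ A B)) ∣A∣≡r)

  s+∣B─A∣≡r : s + ∣ B ─ A ∣ ≡ r
  s+∣B─A∣≡r = trans (cong (_+ ∣ B ─ A ∣) (trans (sym ∣A∩B∣≡s) (cong ∣_∣ (∩-comm A B))))
                    (trans (sym (∣p∣≡∣p∩q∣+∣p─q∣ B A)) ∣B∣≡r)

  s≤r : s ≤ r
  s≤r = ≤-trans (m≤m+n s _) (≤-reflexive s+∣A─B∣≡r)

  ∣∁A∪B∣≡1+s : ∣ ∁ (A ∪ B) ∣ ≡ suc s
  ∣∁A∪B∣≡1+s = +-cancelˡ-≡ (r + ∣ B ─ A ∣) _ _ (begin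
    r + ∣ B ─ A ∣ + ∣ ∁ (A ∪ B) ∣        ≡⟨ cong (λ x → x + ∣ B ─ A ∣ + ∣ ∁ (A ∪ B) ∣) (sym ∣A∣≡r) ⟩
    ∣ A ∣ + ∣ B ─ A ∣ + ∣ ∁ (A ∪ B) ∣    ≡⟨ sym (n≡∣p∣+∣q─p∣+∣∁p∪q∣ A B) ⟩
    suc (r + r)                          ≡⟨ cong (λ x → suc (r + x)) (sym s+∣B─A∣≡r) ⟩
    suc (r + (s + ∣ B ─ A ∣))            ≡⟨ regroup r s ∣ B ─ A ∣ ⟩
    r + ∣ B ─ A ∣ + suc s                ∎)
    where
    open ≡-Reasoning
    regroup : ∀ r s y → suc (r + (s + y)) ≡ r + y + suc s
    regroup = solve-∀

  neighbour-toward-B : ∀ {b d} → b ≤ ∣ B ─ A ∣ → d ≤ suc s → b + d ≡ r →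
    ∃ λ W → A ∩ W ≡ ∅ × ∣ W ∣ ≡ r × ∣ W ∩ B ∣ ≡ b
  neighbour-toward-B b≤ d≤ b+d≡r =
    let W , A∩W≡∅ , ∣W∣≡b+d , ∣W∩B∣≡b = neighbour A B b≤ (≤-trans d≤ (≤-reflexive (sym ∣∁A∪B∣≡1+s)))
    in W , A∩W≡∅ , trans ∣W∣≡b+d b+d≡r , ∣W∩B∣≡b

-- Walks in the Kneser graph K(2r+1, r)

-- L is the least length, among walks of L's parity in the Kneser graph K(2r+1, r), between
-- two vertices meeting in s elements: 2(r − s) for even L and 2s + 1 for odd L.
data WalkLength (r s : ℕ) : ℕ → Set where
  even-length : ∀ {e} → s + e ≡ r → WalkLength r s (e + e)
  odd-length  : s ≤ r → WalkLength r s (suc (s + s))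

data KneserWalk (r : ℕ) : Subset (suc (r + r)) → Subset (suc (r + r)) → ℕ → Set where
  stop : ∀ {A} → KneserWalk r A A 0
  step : ∀ {A W B n} → A ∩ W ≡ ∅ → ∣ W ∣ ≡ r → KneserWalk r W B n → KneserWalk r A B (suc n)

module _ {r : ℕ} where

  even-walk : ∀ e {s} {A B : Subset (suc (r + r))} → s + e ≡ r →
    ∣ A ∣ ≡ r → ∣ B ∣ ≡ r → ∣ A ∩ B ∣ ≡ s → KneserWalk r A B (e + e)
  odd-walk : ∀ s {A B : Subset (suc (r + r))} → s ≤ r →
    ∣ A ∣ ≡ r → ∣ B ∣ ≡ r → ∣ A ∩ B ∣ ≡ s → KneserWalk r A B (suc (s + s))

  even-walk zero {s} {A} {B} s+0≡r ∣A∣ ∣B∣ ∣A∩B∣ = subst (λ X → KneserWalk r A X 0) A≡B stop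
    where
    open RSets A B ∣A∣ ∣B∣ ∣A∩B∣
    A≡B : A ≡ B
    A≡B = ∣p─q∣≡0⇒∣q─p∣≡0⇒p≡q A B (+-cancelˡ-≡ s _ _ (trans s+∣A─B∣≡r (sym s+0≡r)))
                                  (+-cancelˡ-≡ s _ _ (trans s+∣B─A∣≡r (sym s+0≡r)))
  even-walk (suc e) {s} {A} {B} s+1+e≡r ∣A∣ ∣B∣ ∣A∩B∣ =
    let W , A∩W≡∅ , ∣W∣≡r , ∣W∩B∣≡e = neighbour-toward-B e≤∣B─A∣ ≤-refl e+1+s≡r
    in step A∩W≡∅ ∣W∣≡r (subst (KneserWalk r W B) (sym (+-suc e e)) (odd-walk e e≤r ∣W∣≡r ∣B∣ ∣W∩B∣≡e))
    where
    open RSets A B ∣A∣ ∣B∣ ∣A∩B∣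
    e≤∣B─A∣ : e ≤ ∣ B ─ A ∣
    e≤∣B─A∣ = ≤-trans (n≤1+n e) (≤-reflexive (+-cancelˡ-≡ s _ _ (trans s+1+e≡r (sym s+∣B─A∣≡r))))
    e+1+s≡r : e + suc s ≡ r
    e+1+s≡r = trans (+-suc e s) (trans (cong suc (+-comm e s)) (trans (sym (+-suc s e)) s+1+e≡r))
    e≤r : e ≤ r
    e≤r = ≤-trans (n≤1+n e) (≤-trans (m≤n+m (suc e) s) (≤-reflexive s+1+e≡r))

  odd-walk s {A} {B} s≤r ∣A∣ ∣B∣ ∣A∩B∣ =
    let W , A∩W≡∅ , ∣W∣≡r , ∣W∩B∣≡e = neighbour-toward-B ≤-refl (n≤1+n s) (trans (+-comm _ s) s+∣B─A∣≡r)
    in step A∩W≡∅ ∣W∣≡r (even-walk s (trans (+-comm _ s) s+∣B─A∣≡r) ∣W∣≡r ∣B∣ ∣W∩B∣≡e)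
    where open RSets A B ∣A∣ ∣B∣ ∣A∩B∣

  kneserWalk : ∀ {s L} {A B : Subset (suc (r + r))} → WalkLength r s L →
    ∣ A ∣ ≡ r → ∣ B ∣ ≡ r → ∣ A ∩ B ∣ ≡ s → KneserWalk r A B L
  kneserWalk (even-length {e} s+e≡r) = even-walk e s+e≡r
  kneserWalk {s} (odd-length s≤r)    = odd-walk s s≤r

  KneserWalk-0⇒≡ : ∀ {A B : Subset (suc (r + r))} → KneserWalk r A B 0 → A ≡ B
  KneserWalk-0⇒≡ stop = refl

  walkLength-≤ : ∀ {s L} → WalkLength r s L → L ≤ suc (r + r)
  walkLength-≤ {s} (even-length {e} s+e≡r) = m≤n⇒m≤1+n (+-mono-≤ e≤r e≤r)
    where
    e≤r : e ≤ r
    e≤r = ≤-trans (m≤n+m e s) (≤-reflexive s+e≡r)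
  walkLength-≤ (odd-length s≤r) = s≤s (+-mono-≤ s≤r s≤r)

  walkLength-of : ∀ {L} → L ≤ suc (r + r) → ∃ λ s → WalkLength r s L
  walkLength-of {L} L≤ with parity L
  ... | even a = let s , a+s≡r = m≤n⇒∃[o]m+o≡n (m+m≤1+n+n⇒m≤n {a} L≤)
                 in s , even-length {e = a} (trans (+-comm s a) a+s≡r)
  ... | odd a  = a , odd-length (m+m≤1+n+n⇒m≤n (m≤n⇒m≤1+n (≤-pred L≤)))

  walkLength-complement : ∀ {s L L′} → WalkLength r s L → L + L′ ≡ suc (r + r) → WalkLength r s L′
  walkLength-complement {s} {L′ = L′} (even-length {e} s+e≡r) L+L′≡ =
    subst (WalkLength r s) (sym L′≡) (odd-length (≤-trans (m≤m+n s e) (≤-reflexive s+e≡r)))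
    where
    regroup : ∀ s e → suc ((s + e) + (s + e)) ≡ e + e + suc (s + s)
    regroup = solve-∀
    L′≡ : L′ ≡ suc (s + s)
    L′≡ = +-cancelˡ-≡ (e + e) _ _ (trans L+L′≡ (trans (cong (λ x → suc (x + x)) (sym s+e≡r)) (regroup s e)))
  walkLength-complement {s} {L′ = L′} (odd-length s≤r) L+L′≡ =
    subst (WalkLength r s) (sym L′≡) (even-length s+e≡r)
    where
    regroup : ∀ s e → suc ((s + e) + (s + e)) ≡ suc (s + s) + (e + e)
    regroup = solve-∀
    e : ℕ
    e = proj₁ (m≤n⇒∃[o]m+o≡n s≤r)
    s+e≡r : s + e ≡ r
    s+e≡r = proj₂ (m≤n⇒∃[o]m+o≡n s≤r)
    L′≡ : L′ ≡ e + e
    L′≡ = +-cancelˡ-≡ (suc (s + s)) _ _ (trans L+L′≡ (trans (cong (λ x → suc (x + x)) (sym s+e≡r)) (regroup s e)))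

record Triangle (k a b c : ℕ) : Set where
  field
    even-perimeter : Even (a + b + c)
    a≤b+c          : a ≤ b + c
    b≤c+a          : b ≤ c + a
    c≤a+b          : c ≤ a + b
    perimeter≤k+k  : a + b + c ≤ k + k

module _ {k a b c : ℕ} (t : Triangle k a b c) where

  open Triangle t

  Triangle-rotate : Triangle k b c a
  Triangle-rotate = record
    { even-perimeter = subst Even (rotate a b c) even-perimeter
    ; a≤b+c          = b≤c+a
    ; b≤c+a          = c≤a+b
    ; c≤a+b          = a≤b+c
    ; perimeter≤k+k  = subst (_≤ k + k) (rotate a b c) perimeter≤k+k
    }
    where
    rotate : ∀ a b c → a + b + c ≡ b + c + a
    rotate = solve-∀

  Triangle-c≤k : c ≤ k
  Triangle-c≤k = m+m≤n+n⇒m≤n (begin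
    c + c        ≤⟨ +-monoʳ-≤ c c≤a+b ⟩
    c + (a + b)  ≡⟨ +-comm c (a + b) ⟩
    a + b + c    ≤⟨ perimeter≤k+k ⟩
    k + k        ∎)
    where open ≤-Reasoning

  odd-perimeter : ∀ x → a + b + c ≡ suc (x + x) → ⊥
  odd-perimeter x eq = ¬Even-1+n+n x (subst Even eq even-perimeter)

  Triangle-complement : ∀ {b′ c′} → b + b′ ≡ k → c + c′ ≡ k → Triangle k a b′ c′
  Triangle-complement {b′} {c′} b+b′≡k c+c′≡k = record
    { even-perimeter = Even-cancelˡ even-perimeter (a + k , (begin-equality
        a + b + c + (a + b′ + c′)    ≡⟨ regroup a b c b′ c′ ⟩
        a + (b + b′) + (a + (c + c′)) ≡⟨ cong₂ (λ x y → a + x + (a + y)) b+b′≡k c+c′≡k ⟩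
        a + k + (a + k)              ∎))
    ; a≤b+c = linear-≤ 0 (+-mono-≤ (+-mono-≤ perimeter≤k+k k≤b+b′) k≤c+c′) (solve (a ∷ b ∷ c ∷ b′ ∷ c′ ∷ k ∷ []))
    ; b≤c+a = linear-≤ 0 (+-mono-≤ c≤a+b (≤-reflexive (trans b+b′≡k (sym c+c′≡k)))) (solve (a ∷ b ∷ c ∷ b′ ∷ c′ ∷ []))
    ; c≤a+b = linear-≤ 0 (+-mono-≤ b≤c+a (≤-reflexive (trans c+c′≡k (sym b+b′≡k)))) (solve (a ∷ b ∷ c ∷ b′ ∷ c′ ∷ []))
    ; perimeter≤k+k = linear-≤ 0 (+-mono-≤ (+-mono-≤ a≤b+c (≤-reflexive b+b′≡k)) (≤-reflexive c+c′≡k))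
                        (solve (a ∷ b ∷ c ∷ b′ ∷ c′ ∷ k ∷ []))
    }
    where
    open ≤-Reasoning
    regroup : ∀ a b c b′ c′ → a + b + c + (a + b′ + c′) ≡ a + (b + b′) + (a + (c + c′))
    regroup = solve-∀
    k≤b+b′ : k ≤ b + b′
    k≤b+b′ = ≤-reflexive (sym b+b′≡k)
    k≤c+c′ : k ≤ c + c′
    k≤c+c′ = ≤-reflexive (sym c+c′≡k)

Triangle-degenerate : ∀ {k b c} → b + c ≤ k → Triangle k (b + c) b c
Triangle-degenerate {k} {b} {c} b+c≤k = record
  { even-perimeter = b + c , +-assoc (b + c) b c
  ; a≤b+c          = ≤-refl
  ; b≤c+a          = ≤-trans (m≤m+n b c) (m≤n+m (b + c) c)
  ; c≤a+b          = ≤-trans (m≤n+m c b) (m≤m+n (b + c) b)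
  ; perimeter≤k+k  = subst (_≤ k + k) (sym (+-assoc (b + c) b c)) (+-mono-≤ b+c≤k b+c≤k)
  }

-- The triangle inequalities and the perimeter bound 2r + 1 for sides e, r − α, r − β, where r = s + e.
record Feasible (s e α β : ℕ) : Set where
  field
    e≤1+α+β   : e ≤ suc (α + β)
    α+β≤s+s+e : α + β ≤ s + s + e
    α≤e+β     : α ≤ e + β
    β≤e+α     : β ≤ e + α

module _ {r : ℕ} where

  feasible-even : ∀ {s α β e₀ e₁ e₂} → s + e₀ ≡ r → α + e₁ ≡ r → β + e₂ ≡ r →
    Triangle (suc (r + r)) (e₀ + e₀) (e₁ + e₁) (e₂ + e₂) → Feasible s e₀ α β
  feasible-even {s} {α} {β} {e₀} {e₁} {e₂} s+e₀≡r α+e₁≡r β+e₂≡r t = record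
    { e≤1+α+β   = linear-≤ 0 (+-mono-≤ (+-mono-≤ e₀+e₁+e₂≤k (r≤ α+e₁≡r)) (r≤ β+e₂≡r))
                    (solve (α ∷ β ∷ e₀ ∷ e₁ ∷ e₂ ∷ r ∷ []))
    ; α+β≤s+s+e = linear-≤ 0 (+-mono-≤ (+-mono-≤ (+-mono-≤ (+-mono-≤ e₀≤e₁+e₂
                    (≤-reflexive α+e₁≡r)) (≤-reflexive β+e₂≡r)) (r≤ s+e₀≡r)) (r≤ s+e₀≡r))
                    (solve (s ∷ α ∷ β ∷ e₀ ∷ e₁ ∷ e₂ ∷ r ∷ []))
    ; α≤e+β     = linear-≤ 0 (+-mono-≤ (+-mono-≤ e₂≤e₀+e₁ (≤-reflexive α+e₁≡r)) (r≤ β+e₂≡r))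
                    (solve (α ∷ β ∷ e₀ ∷ e₁ ∷ e₂ ∷ r ∷ []))
    ; β≤e+α     = linear-≤ 0 (+-mono-≤ (+-mono-≤ e₁≤e₂+e₀ (≤-reflexive β+e₂≡r)) (r≤ α+e₁≡r))
                    (solve (α ∷ β ∷ e₀ ∷ e₁ ∷ e₂ ∷ r ∷ []))
    }
    where
    open Triangle t
    r≤ : ∀ {x} → x ≡ r → r ≤ x
    r≤ eq = ≤-reflexive (sym eq)
    regroup : ∀ x y z → x + x + (y + y) + (z + z) ≡ (x + y + z) + (x + y + z)
    regroup = solve-∀
    e₀+e₁+e₂≤k : e₀ + e₁ + e₂ ≤ suc (r + r)
    e₀+e₁+e₂≤k = m+m≤n+n⇒m≤n (subst (_≤ suc (r + r) + suc (r + r)) (regroup e₀ e₁ e₂) perimeter≤k+k)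
    e₀≤e₁+e₂ : e₀ ≤ e₁ + e₂
    e₀≤e₁+e₂ = m+m≤n+n+o+o⇒m≤n+o {e₀} {e₁} {e₂} a≤b+c
    e₁≤e₂+e₀ : e₁ ≤ e₂ + e₀
    e₁≤e₂+e₀ = m+m≤n+n+o+o⇒m≤n+o {e₁} {e₂} {e₀} b≤c+a
    e₂≤e₀+e₁ : e₂ ≤ e₀ + e₁
    e₂≤e₀+e₁ = m+m≤n+n+o+o⇒m≤n+o {e₂} {e₀} {e₁} c≤a+b

  odd-complement : ∀ {s} → s ≤ r → ∃ λ e → s + e ≡ r × suc (s + s) + (e + e) ≡ suc (r + r)
  odd-complement {s} s≤r =
    let e , s+e≡r = m≤n⇒∃[o]m+o≡n s≤r
    in e , s+e≡r , trans (regroup s e) (cong (λ x → suc (x + x)) s+e≡r)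
    where
    regroup : ∀ s e → suc (s + s) + (e + e) ≡ suc ((s + e) + (s + e))
    regroup = solve-∀

  -- Complementing the two odd sides (there are zero or two) reduces to the all-even case.
  feasible : ∀ {s α β h l h′} → WalkLength r s h → WalkLength r α l → WalkLength r β h′ →
    Triangle (suc (r + r)) h l h′ → ∃ λ e → s + e ≡ r × Feasible s e α β
  feasible (even-length p₀) (even-length p₁) (even-length p₂) t = _ , p₀ , feasible-even p₀ p₁ p₂ t
  feasible (even-length p₀) (odd-length q₁) (odd-length q₂) t =
    let _ , p₁ , c₁ = odd-complement q₁ ; _ , p₂ , c₂ = odd-complement q₂
    in _ , p₀ , feasible-even p₀ p₁ p₂ (Triangle-complement t c₁ c₂)
  feasible (odd-length q₀) (even-length p₁) (odd-length q₂) t =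
    let _ , p₀ , c₀ = odd-complement q₀ ; _ , p₂ , c₂ = odd-complement q₂
    in _ , p₀ , feasible-even p₀ p₁ p₂
                  (Triangle-rotate (Triangle-rotate (Triangle-complement (Triangle-rotate t) c₂ c₀)))
  feasible (odd-length q₀) (odd-length q₁) (even-length p₂) t =
    let _ , p₀ , c₀ = odd-complement q₀ ; _ , p₁ , c₁ = odd-complement q₁
    in _ , p₀ , feasible-even p₀ p₁ p₂
                  (Triangle-rotate (Triangle-complement (Triangle-rotate (Triangle-rotate t)) c₀ c₁))
  feasible {β = β} (even-length {e₀} _) (even-length {e₁} _) (odd-length _) t =
    ⊥-elim (odd-perimeter t (e₀ + e₁ + β) (regroup e₀ e₁ β))
    where
    regroup : ∀ x y z → x + x + (y + y) + suc (z + z) ≡ suc ((x + y + z) + (x + y + z))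
    regroup = solve-∀
  feasible {α = α} (even-length {e₀} _) (odd-length _) (even-length {e₂} _) t =
    ⊥-elim (odd-perimeter t (e₀ + α + e₂) (regroup e₀ α e₂))
    where
    regroup : ∀ x y z → x + x + suc (y + y) + (z + z) ≡ suc ((x + y + z) + (x + y + z))
    regroup = solve-∀
  feasible {s = s} (odd-length _) (even-length {e₁} _) (even-length {e₂} _) t =
    ⊥-elim (odd-perimeter t (s + e₁ + e₂) (regroup s e₁ e₂))
    where
    regroup : ∀ x y z → suc (x + x) + (y + y) + (z + z) ≡ suc ((x + y + z) + (x + y + z))
    regroup = solve-∀
  feasible {s} {α} {β} (odd-length _) (odd-length _) (odd-length _) t =
    ⊥-elim (odd-perimeter t (suc (s + α + β)) (regroup s α β))
    where
    regroup : ∀ x y z → suc (x + x) + suc (y + y) + suc (z + z) ≡ suc (suc (x + y + z) + suc (x + y + z))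
    regroup = solve-∀

-- a is the rounded-down half of 1 + α + β − e; then b = α − a, c = β − a, d = s + e − α − β + a.
cell-sizes : ∀ {s e α β} → Feasible s e α β → ∃ λ a → ∃ λ b → ∃ λ c → ∃ λ d →
  a + b ≡ α × a + c ≡ β × a + b + c + d ≡ s + e × a ≤ s × b ≤ e × c ≤ e × d ≤ suc s
cell-sizes {s} {e} {α} {β} f with m≤n⇒∃[o]m+o≡n (Feasible.e≤1+α+β f)
... | N , e+N≡ with halve N
... | a , ε , ε≤1 , refl = a , b , c , d , a+b≡α , a+c≡β , sum≡s+e , a≤s , b≤e , c≤e , d≤1+s
  where
  open Feasible f
  a≤s : a ≤ s
  a≤s = m+m≤1+n+n⇒m≤n (linear-≤ ε (+-mono-≤ α+β≤s+s+e (≤-reflexive e+N≡)) (solve (a ∷ s ∷ e ∷ α ∷ β ∷ ε ∷ [])))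
  a≤α : a ≤ α
  a≤α = m+m≤1+n+n⇒m≤n (linear-≤ ε (+-mono-≤ β≤e+α (≤-reflexive e+N≡)) (solve (a ∷ e ∷ α ∷ β ∷ ε ∷ [])))
  a≤β : a ≤ β
  a≤β = m+m≤1+n+n⇒m≤n (linear-≤ ε (+-mono-≤ α≤e+β (≤-reflexive e+N≡)) (solve (a ∷ e ∷ α ∷ β ∷ ε ∷ [])))
  α≤a+e : α ≤ a + e
  α≤a+e = m+m≤n+n⇒m≤n (linear-≤ 0 (+-mono-≤ (+-mono-≤ α≤e+β (≤-reflexive (sym e+N≡))) ε≤1)
            (solve (a ∷ e ∷ α ∷ β ∷ ε ∷ [])))
  β≤a+e : β ≤ a + e
  β≤a+e = m+m≤n+n⇒m≤n (linear-≤ 0 (+-mono-≤ (+-mono-≤ β≤e+α (≤-reflexive (sym e+N≡))) ε≤1)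
            (solve (a ∷ e ∷ α ∷ β ∷ ε ∷ [])))
  α+β≤a+s+e : α + β ≤ a + (s + e)
  α+β≤a+s+e = m+m≤n+n⇒m≤n (linear-≤ 0 (+-mono-≤ (+-mono-≤ α+β≤s+s+e (≤-reflexive (sym e+N≡))) ε≤1)
                (solve (a ∷ s ∷ e ∷ α ∷ β ∷ ε ∷ [])))
  a+s+e≤α+β+1+s : a + (s + e) ≤ α + β + suc s
  a+s+e≤α+β+1+s = m+m≤n+n⇒m≤n (linear-≤ ε (+-mono-≤ (≤-reflexive e+N≡) e≤1+α+β)
                    (solve (a ∷ s ∷ e ∷ α ∷ β ∷ ε ∷ [])))
  b c d : ℕ
  b = proj₁ (m≤n⇒∃[o]m+o≡n a≤α)
  c = proj₁ (m≤n⇒∃[o]m+o≡n a≤β)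
  d = proj₁ (m≤n⇒∃[o]m+o≡n α+β≤a+s+e)
  a+b≡α : a + b ≡ α
  a+b≡α = proj₂ (m≤n⇒∃[o]m+o≡n a≤α)
  a+c≡β : a + c ≡ β
  a+c≡β = proj₂ (m≤n⇒∃[o]m+o≡n a≤β)
  α+β+d≡ : α + β + d ≡ a + (s + e)
  α+β+d≡ = proj₂ (m≤n⇒∃[o]m+o≡n α+β≤a+s+e)
  regroup : ∀ a b c d → a + (a + b + c + d) ≡ (a + b) + (a + c) + d
  regroup = solve-∀
  sum≡s+e : a + b + c + d ≡ s + e
  sum≡s+e = +-cancelˡ-≡ a _ _ (trans (regroup a b c d)
              (trans (cong₂ (λ x y → x + y + d) a+b≡α a+c≡β) α+β+d≡))
  b≤e : b ≤ e
  b≤e = +-cancelˡ-≤ a b e (subst (_≤ a + e) (sym a+b≡α) α≤a+e)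
  c≤e : c ≤ e
  c≤e = +-cancelˡ-≤ a c e (subst (_≤ a + e) (sym a+c≡β) β≤a+e)
  d≤1+s : d ≤ suc s
  d≤1+s = +-cancelˡ-≤ (α + β) d (suc s) (≤-trans (≤-reflexive α+β+d≡) a+s+e≤α+β+1+s)

triangle-vertex : ∀ {r s α β h l h′} → WalkLength r s h → WalkLength r α l → WalkLength r β h′ →
  Triangle (suc (r + r)) h l h′ → (A B : Subset (suc (r + r))) → ∣ A ∣ ≡ r → ∣ B ∣ ≡ r → ∣ A ∩ B ∣ ≡ s →
  ∃ λ W → ∣ W ∣ ≡ r × ∣ A ∩ W ∣ ≡ α × ∣ W ∩ B ∣ ≡ β
triangle-vertex {s = s} wh wl wh′ t A B ∣A∣ ∣B∣ ∣A∩B∣ =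
  let e , s+e≡r , f = feasible wh wl wh′ t
      a , b , c , d , a+b≡α , a+c≡β , sum , a≤s , b≤e , c≤e , d≤1+s = cell-sizes f
      ∣A─B∣≡e = +-cancelˡ-≡ s _ _ (trans s+∣A─B∣≡r (sym s+e≡r))
      ∣B─A∣≡e = +-cancelˡ-≡ s _ _ (trans s+∣B─A∣≡r (sym s+e≡r))
      W , ∣W∣ , ∣A∩W∣ , ∣W∩B∣ = choose A B
        (≤-trans a≤s (≤-reflexive (sym ∣A∩B∣))) (≤-trans b≤e (≤-reflexive (sym ∣A─B∣≡e)))
        (≤-trans c≤e (≤-reflexive (sym ∣B─A∣≡e))) (≤-trans d≤1+s (≤-reflexive (sym ∣∁A∪B∣≡1+s)))
  in W , trans ∣W∣ (trans sum s+e≡r) , trans ∣A∩W∣ a+b≡α , trans ∣W∩B∣ a+c≡β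
  where open RSets A B ∣A∣ ∣B∣ ∣A∩B∣

-- Colouring the path of a necklace

-- h is a walk length from the current colour to B, and T the total length of the shortest arcs
-- of the segments still to be coloured.
record Reach (r h T : ℕ) : Set where
  field
    h≤T           : h ≤ T
    even-h+T      : Even (h + T)
    exact-or-long : h ≡ T ⊎ suc (suc (r + r)) ≤ h + T

Gap : ℕ → ℕ → ℕ → Set
Gap h l g = h ≡ l + g ⊎ l ≡ h + g

gap : ∀ h l → ∃ (Gap h l)
gap h l with l ≤? h
... | yes l≤h = let g , l+g≡h = m≤n⇒∃[o]m+o≡n l≤h in g , inj₁ (sym l+g≡h)
... | no  l≰h = let g , h+g≡l = m≤n⇒∃[o]m+o≡n (<⇒≤ (≰⇒> l≰h)) in g , inj₂ (sym h+g≡l)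

module _ {r h l T′ : ℕ} (l≤r : l ≤ r) (h≤k : h ≤ suc (r + r)) (R : Reach r h (l + T′)) where

  open Reach R

  step-short : T′ ≤ r → Triangle (suc (r + r)) h l T′ × Reach r T′ T′
  step-short T′≤r = record
    { even-perimeter = subst Even (sym (+-assoc h l T′)) even-h+T
    ; a≤b+c          = h≤T
    ; b≤c+a          = l≤T′+h exact-or-long
    ; c≤a+b          = T′≤h+l exact-or-long
    ; perimeter≤k+k  = linear-≤ 1 (+-mono-≤ (+-mono-≤ h≤k l≤r) T′≤r) (solve (h ∷ l ∷ T′ ∷ r ∷ []))
    } , record { h≤T = ≤-refl ; even-h+T = T′ , refl ; exact-or-long = inj₁ refl }
    where
    open ≤-Reasoning
    l≤T′+h : h ≡ l + T′ ⊎ suc (suc (r + r)) ≤ h + (l + T′) → l ≤ T′ + h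
    l≤T′+h (inj₁ h≡l+T′) = begin l ≤⟨ m≤m+n l T′ ⟩ l + T′ ≡⟨ sym h≡l+T′ ⟩ h ≤⟨ m≤n+m h T′ ⟩ T′ + h ∎
    l≤T′+h (inj₂ long)   = linear-≤ 2 (+-mono-≤ (+-mono-≤ long l≤r) l≤r) (solve (h ∷ l ∷ T′ ∷ r ∷ []))
    T′≤h+l : h ≡ l + T′ ⊎ suc (suc (r + r)) ≤ h + (l + T′) → T′ ≤ h + l
    T′≤h+l (inj₁ h≡l+T′) = begin T′ ≤⟨ m≤n+m T′ l ⟩ l + T′ ≡⟨ sym h≡l+T′ ⟩ h ≤⟨ m≤m+n h l ⟩ h + l ∎
    T′≤h+l (inj₂ long)   = linear-≤ 2 (+-mono-≤ (+-mono-≤ long T′≤r) T′≤r) (solve (h ∷ l ∷ T′ ∷ r ∷ []))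

  step-gap : ∀ {g} → r < T′ → Gap h l g → suc (suc (r + r)) ≤ g + T′ →
    Triangle (suc (r + r)) h l g × Reach r g T′
  step-gap {g} r<T′ (inj₁ h≡l+g) long =
    subst (λ x → Triangle _ x l g) (sym h≡l+g) (Triangle-degenerate (subst (_≤ suc (r + r)) h≡l+g h≤k)) ,
    record { h≤T           = +-cancelˡ-≤ l g T′ (subst (_≤ l + T′) h≡l+g h≤T)
           ; even-h+T      = Even-cancelˡ (l , refl) (subst Even sum≡ even-h+T)
           ; exact-or-long = inj₂ long }
    where
    regroup : ∀ l g T′ → l + g + (l + T′) ≡ l + l + (g + T′)
    regroup = solve-∀
    sum≡ : h + (l + T′) ≡ l + l + (g + T′)
    sum≡ = trans (cong (_+ (l + T′)) h≡l+g) (regroup l g T′)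
  step-gap {g} r<T′ (inj₂ l≡h+g) long =
    Triangle-rotate (Triangle-rotate (subst (λ x → Triangle _ x g h) g+h≡l (Triangle-degenerate g+h≤k))) ,
    record { h≤T           = ≤-trans (m≤n+m g h) (≤-trans (≤-reflexive (sym l≡h+g)) (≤-trans l≤r (<⇒≤ r<T′)))
           ; even-h+T      = Even-cancelˡ (h , refl) (subst Even sum≡ even-h+T)
           ; exact-or-long = inj₂ long }
    where
    regroup : ∀ h g T′ → h + (h + g + T′) ≡ h + h + (g + T′)
    regroup = solve-∀
    sum≡ : h + (l + T′) ≡ h + h + (g + T′)
    sum≡ = trans (cong (λ x → h + (x + T′)) l≡h+g) (regroup h g T′)
    g+h≡l : g + h ≡ l
    g+h≡l = trans (+-comm g h) (sym l≡h+g)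
    g+h≤k : g + h ≤ suc (r + r)
    g+h≤k = ≤-trans (≤-reflexive g+h≡l) (≤-trans l≤r (m≤n⇒m≤1+n (m≤m+n r r)))

  step-far : ∀ {g m} → r < T′ → Gap h l g → g + T′ ≤ suc (r + r) → m + T′ ≡ suc (suc (r + r)) →
    Triangle (suc (r + r)) h l m × Reach r m T′
  step-far {g} {m} r<T′ hlg g+T′≤k m+T′≡ = record
    { even-perimeter = Even-cancelˡ (T′ , refl)
        (subst Even (regroup h l m T′) (Even-+ even-h+T (suc r , trans m+T′≡ (cong suc (sym (+-suc r r))))))
    ; a≤b+c          = h≤l+m hlg
    ; b≤c+a          = l≤m+h hlg
    ; c≤a+b          = m≤h+l exact-or-long
    ; perimeter≤k+k  = linear-≤ 0 (+-mono-≤ (+-mono-≤ h≤k l≤r) m≤1+r) (solve (h ∷ l ∷ m ∷ r ∷ []))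
    } , record { h≤T = ≤-trans m≤1+r r<T′ ; even-h+T = suc r , trans m+T′≡ (cong suc (sym (+-suc r r)))
               ; exact-or-long = inj₂ (≤-reflexive (sym m+T′≡)) }
    where
    open ≤-Reasoning
    regroup : ∀ h l m T′ → h + (l + T′) + (m + T′) ≡ T′ + T′ + (h + l + m)
    regroup = solve-∀
    m≤1+r : m ≤ suc r
    m≤1+r = linear-≤ 0 (+-mono-≤ (≤-reflexive m+T′≡) r<T′) (solve (m ∷ T′ ∷ r ∷ []))
    g≤m : g ≤ m
    g≤m = <⇒≤ (+-cancelʳ-≤ T′ (suc g) m (≤-trans (s≤s g+T′≤k) (≤-reflexive (sym m+T′≡))))
    h≤l+m : Gap h l g → h ≤ l + m
    h≤l+m (inj₁ h≡l+g) = begin h ≡⟨ h≡l+g ⟩ l + g ≤⟨ +-monoʳ-≤ l g≤m ⟩ l + m ∎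
    h≤l+m (inj₂ l≡h+g) = begin h ≤⟨ m≤m+n h g ⟩ h + g ≡⟨ sym l≡h+g ⟩ l ≤⟨ m≤m+n l m ⟩ l + m ∎
    l≤m+h : Gap h l g → l ≤ m + h
    l≤m+h (inj₁ h≡l+g) = begin l ≤⟨ m≤m+n l g ⟩ l + g ≡⟨ sym h≡l+g ⟩ h ≤⟨ m≤n+m h m ⟩ m + h ∎
    l≤m+h (inj₂ l≡h+g) = begin l ≡⟨ l≡h+g ⟩ h + g ≤⟨ +-monoʳ-≤ h g≤m ⟩ h + m ≡⟨ +-comm h m ⟩ m + h ∎
    m≤h+l : h ≡ l + T′ ⊎ suc (suc (r + r)) ≤ h + (l + T′) → m ≤ h + l
    m≤h+l (inj₁ h≡l+T′) = begin
      m      ≤⟨ ≤-trans m≤1+r r<T′ ⟩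
      T′     ≤⟨ m≤n+m T′ l ⟩
      l + T′ ≡⟨ sym h≡l+T′ ⟩
      h      ≤⟨ m≤m+n h l ⟩
      h + l  ∎
    m≤h+l (inj₂ long) = linear-≤ 0 (+-mono-≤ (≤-reflexive m+T′≡) long) (solve (h ∷ l ∷ m ∷ T′ ∷ r ∷ []))

-- The next walk length is T′ if T′ ≤ r, and max(|h − l|, 2r + 2 − T′) otherwise.
step-lengths : ∀ {r h l T′} → l ≤ r → h ≤ suc (r + r) → Reach r h (l + T′) →
  ∃ λ h′ → Triangle (suc (r + r)) h l h′ × Reach r h′ T′
step-lengths {r} {h} {l} {T′} l≤r h≤k R with T′ ≤? r
... | yes T′≤r = T′ , step-short l≤r h≤k R T′≤r
... | no  T′≰r with gap h l
... | g , hlg with suc (suc (r + r)) ≤? g + T′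
... | yes long = g , step-gap l≤r h≤k R (≰⇒> T′≰r) hlg long
... | no  short = m , step-far l≤r h≤k R (≰⇒> T′≰r) hlg (≤-pred (≰⇒> short)) (trans (+-comm m T′) T′+m≡)
  where
  T′≤ : T′ ≤ suc (suc (r + r))
  T′≤ = ≤-trans (m≤n+m T′ g) (<⇒≤ (≰⇒> short))
  m : ℕ
  m = proj₁ (m≤n⇒∃[o]m+o≡n T′≤)
  T′+m≡ : T′ + m ≡ suc (suc (r + r))
  T′+m≡ = proj₂ (m≤n⇒∃[o]m+o≡n T′≤)

initial-reach : ∀ {r s T} → s ≤ r → r + r ≤ s + s + T → suc (s + s) ≤ T →
  ∃ λ h → WalkLength r s h × Reach r h T
initial-reach {r} {s} {T} s≤r r+r≤ 1+s+s≤T with parity T | m≤n⇒∃[o]m+o≡n s≤r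
... | even u | e , s+e≡r = e + e , even-length s+e≡r , record
  { h≤T           = linear-≤ 0 (+-mono-≤ (+-mono-≤ r+r≤ (≤-reflexive s+e≡r)) (≤-reflexive s+e≡r))
                      (solve (s ∷ e ∷ u ∷ r ∷ []))
  ; even-h+T      = e + u , solve (e ∷ u ∷ [])
  ; exact-or-long = inj₂ (linear-≤ 0 (+-mono-≤ (+-mono-≤ (+-mono-≤ s<u s<u) r≤) r≤) (solve (s ∷ e ∷ u ∷ r ∷ [])))
  }
  where
  s<u : s < u
  s<u = 1+m+m≤n+n⇒m<n {s} {u} 1+s+s≤T
  r≤ : r ≤ s + e
  r≤ = ≤-reflexive (sym s+e≡r)
... | odd u | _ = suc (s + s) , odd-length s≤r , record
  { h≤T           = 1+s+s≤T
  ; even-h+T      = suc (s + u) , solve (s ∷ u ∷ [])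
  ; exact-or-long = inj₂ (linear-≤ 0 (+-mono-≤ r≤s+u r≤s+u) (solve (s ∷ u ∷ r ∷ [])))
  }
  where
  regroup : ∀ s u → s + s + suc (u + u) ≡ suc ((s + u) + (s + u))
  regroup = solve-∀
  r≤s+u : r ≤ s + u
  r≤s+u = m+m≤1+n+n⇒m≤n (subst (r + r ≤_) (regroup s u) r+r≤)

colour-path : ∀ {r} m (l α : Fin m → ℕ) → (∀ i → l i ≤ r) → (∀ i → WalkLength r (α i) (l i)) →
  ∀ {s h} (A B : Subset (suc (r + r))) → ∣ A ∣ ≡ r → ∣ B ∣ ≡ r → ∣ A ∩ B ∣ ≡ s →
  WalkLength r s h → Reach r h (foldr _+_ 0 l) →
  ∃ λ (c : Fin (suc m) → Subset (suc (r + r))) → c zero ≡ A × c (fromℕ m) ≡ B ×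
    (∀ j → ∣ c j ∣ ≡ r) × (∀ i → ∣ c (inject₁ i) ∩ c (suc i) ∣ ≡ α i)
colour-path zero l α l≤r wl {s} A B ∣A∣ ∣B∣ ∣A∩B∣ wh R =
  (λ _ → A) , refl , A≡B , (λ _ → ∣A∣) , λ ()
  where
  A≡B : A ≡ B
  A≡B = KneserWalk-0⇒≡ (kneserWalk (subst (WalkLength _ s) (n≤0⇒n≡0 (Reach.h≤T R)) wh) ∣A∣ ∣B∣ ∣A∩B∣)
colour-path (suc m) l α l≤r wl A B ∣A∣ ∣B∣ ∣A∩B∣ wh R =
  let h′ , t , R′ = step-lengths (l≤r zero) (walkLength-≤ wh) R
      β , wh′ = walkLength-of (Triangle-c≤k t)
      W , ∣W∣ , ∣A∩W∣ , ∣W∩B∣ = triangle-vertex wh (wl zero) wh′ t A B ∣A∣ ∣B∣ ∣A∩B∣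
      c , c₀≡W , cₘ≡B , ∣c∣ , ∣c∩c∣ =
        colour-path m (λ i → l (suc i)) (λ i → α (suc i)) (λ i → l≤r (suc i)) (λ i → wl (suc i))
                    W B ∣W∣ ∣B∣ ∣W∩B∣ wh′ R′
  in (λ { zero → A ; (suc j) → c j }) , refl , cₘ≡B ,
     (λ { zero → ∣A∣ ; (suc j) → ∣c∣ j }) ,
     λ { zero → trans (cong (λ X → ∣ A ∩ X ∣) c₀≡W) ∣A∩W∣ ; (suc i) → ∣c∩c∣ i }

module _ {G : Graph} where

  walk-along : ∀ {n} (u v : V G) (f : Fin n → V G) →
    (∀ j → Edge G (arcPos u v f (inject₁ j)) (arcPos u v f (suc j))) → Walk G u v (suc n)
  walk-along {zero}  u v f e = cons (e zero) nil
  walk-along {suc n} u v f e = cons (e zero) (walk-along (f zero) v (λ i → f (suc i)) (λ j → e (suc j)))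

  _++ᵂ_ : ∀ {u v w n n′} → Walk G u v n → Walk G v w n′ → Walk G u w (n + n′)
  nil      ++ᵂ q = q
  cons e p ++ᵂ q = cons e (p ++ᵂ q)

Walk-map : ∀ {G H : Graph} (g : V G → V H) → (∀ {u v} → Edge G u v → Edge H (g u) (g v)) →
  ∀ {u v n} → Walk G u v n → Walk H (g u) (g v) n
Walk-map g eg nil        = nil
Walk-map g eg (cons e p) = cons (eg e) (Walk-map g eg p)

arcPos-map : ∀ {A B : Set} (g : A → B) {n} (u v : A) (f : Fin n → A) (j : Fin (suc (suc n))) →
  g (arcPos u v f j) ≡ arcPos (g u) (g v) (λ i → g (f i)) j
arcPos-map g         u v f zero       = refl
arcPos-map g {zero}  u v f (suc zero) = refl
arcPos-map g {suc n} u v f (suc j)    = arcPos-map g (f zero) v (λ i → f (suc i)) j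

module _ {k m : ℕ} (segs : Fin (suc m) → Seg k) where

  private
    module N  = Necklace k (suc m) segs
    module N′ = Necklace k m (λ i → segs (suc i))

  drop-first : N′.NV → N.NV
  drop-first (Necklace.pv j)     = Necklace.pv (suc j)
  drop-first (Necklace.av i a j) = Necklace.av (suc i) a j

  drop-first-adj : ∀ {u v} → N′.Adj u v → N.Adj (drop-first u) (drop-first v)
  drop-first-adj (Necklace.arcE i a j) =
    subst₂ N.Adj (sym (arcPos-map drop-first _ _ _ (inject₁ j))) (sym (arcPos-map drop-first _ _ _ (suc j)))
      (N.arcE (suc i) a j)

  drop-first-edge : ∀ {u v} → Edge N′.graph u v → Edge N.graph (drop-first u) (drop-first v)
  drop-first-edge (inj₁ uv) = inj₁ (drop-first-adj uv)
  drop-first-edge (inj₂ vu) = inj₂ (drop-first-adj vu)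

best-walk : ∀ {k} m (segs : Fin m → Seg k) (best : ∀ i → Arc (segs i)) →
  Walk (Necklace.graph k m segs) (Necklace.x k m segs) (Necklace.y k m segs)
       (foldr _+_ 0 (λ i → suc (inner (segs i) (best i))))
best-walk zero    segs best = nil
best-walk (suc m) segs best =
  walk-along (Necklace.pv zero) (Necklace.pv (suc zero)) (Necklace.av zero (best zero))
             (λ j → inj₁ (Necklace.arcE zero (best zero) j))
  ++ᵂ Walk-map (drop-first segs) (drop-first-edge segs) (best-walk m (λ i → segs (suc i)) (λ i → best (suc i)))

record SegmentProfile (r : ℕ) (s : Seg (suc (r + r))) : Set where
  field
    best        : Arc s
    α           : ℕ
    best≤r      : suc (inner s best) ≤ r
    walkLength  : ∀ a → WalkLength r α (suc (inner s a))

module _ {r : ℕ} where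

  -- 1 ≤ r makes the truncated subtraction suc (r + r) ∸ 2 exact.
  arcs-sum : ∀ {p q} → 1 ≤ r → p + q ≡ suc (r + r) ∸ 2 → suc p + suc q ≡ suc (r + r)
  arcs-sum {p} {q} (s≤s z≤n) p+q≡ = cong suc (trans (+-suc p q) (cong suc p+q≡))

  cycle-lengths : ∀ {x y} → x ≤ y → suc x + suc y ≡ suc (r + r) →
    ∃ λ α → suc x ≤ r × WalkLength r α (suc x) × WalkLength r α (suc y)
  cycle-lengths {x} {y} x≤y sum =
    let α , w = walkLength-of (≤-trans (m≤m+n (suc x) (suc y)) (≤-reflexive sum))
    in α , m+m≤1+n+n⇒m≤n (≤-trans (+-monoʳ-≤ (suc x) (s≤s x≤y)) (≤-reflexive sum)) , w , walkLength-complement w sum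

  segmentProfile : 1 ≤ r → (s : Seg (suc (r + r))) → SegmentProfile r s
  segmentProfile 1≤r plain = record { best = tt ; α = 0 ; best≤r = 1≤r ; walkLength = λ _ → odd-length z≤n }
  segmentProfile 1≤r (cyc p q p+q≡) with p ≤? q
  ... | yes p≤q =
    let α , best≤r , wp , wq = cycle-lengths p≤q (arcs-sum 1≤r p+q≡)
    in record
    { best = true ; α = α ; best≤r = best≤r ; walkLength = λ { true → wp ; false → wq } }
  ... | no  p≰q =
    let α , best≤r , wq , wp = cycle-lengths (<⇒≤ (≰⇒> p≰q)) (trans (+-comm (suc q) (suc p)) (arcs-sum 1≤r p+q≡))
    in record
    { best = false ; α = α ; best≤r = best≤r ; walkLength = λ { true → wp ; false → wq } }

  interior : ∀ {A B n} → KneserWalk r A B (suc n) → Fin n → Subset (suc (r + r))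
  interior {n = suc n} (step {W = W} _ _ _) zero    = W
  interior {n = suc n} (step _ _ w)          (suc j) = interior w j

  interior-size : ∀ {A B n} (w : KneserWalk r A B (suc n)) j → ∣ interior w j ∣ ≡ r
  interior-size {n = suc n} (step _ ∣W∣ _) zero    = ∣W∣
  interior-size {n = suc n} (step _ _ w)   (suc j) = interior-size w j

  interior-disjoint : ∀ {A B n} (w : KneserWalk r A B (suc n)) j →
    arcPos A B (interior w) (inject₁ j) ∩ arcPos A B (interior w) (suc j) ≡ ∅
  interior-disjoint {n = zero}  (step A∩B≡∅ _ stop) zero    = A∩B≡∅
  interior-disjoint {n = suc n} (step A∩W≡∅ _ _)    zero    = A∩W≡∅
  interior-disjoint {n = suc n} (step _ _ w)        (suc j) = interior-disjoint w j

module _ {r m} (segs : Fin m → Seg (suc (r + r))) (prof : ∀ i → SegmentProfile r (segs i))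
  (c : Fin (suc m) → Subset (suc (r + r))) (∣c∣ : ∀ j → ∣ c j ∣ ≡ r)
  (∣c∩c∣ : ∀ i → ∣ c (inject₁ i) ∩ c (suc i) ∣ ≡ SegmentProfile.α (prof i)) where

  open Necklace (suc (r + r)) m segs

  arc-walk : (i : Fin m) (a : Arc (segs i)) → KneserWalk r (c (inject₁ i)) (c (suc i)) (suc (inner (segs i) a))
  arc-walk i a = kneserWalk (SegmentProfile.walkLength (prof i) a) (∣c∣ _) (∣c∣ _) (∣c∩c∣ i)

  extend : NV → Subset (suc (r + r))
  extend (pv j)     = c j
  extend (av i a j) = interior (arc-walk i a) j

  extend-adj : ∀ {u v} → Adj u v → extend u ∩ extend v ≡ ∅
  extend-adj (arcE i a j)
    rewrite arcPos-map extend (pv (inject₁ i)) (pv (suc i)) (av i a) (inject₁ j)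
          | arcPos-map extend (pv (inject₁ i)) (pv (suc i)) (av i a) (suc j) = interior-disjoint (arc-walk i a) j

  extend-colouring : IsFracColoring graph (suc (r + r)) r extend
  extend-colouring = size , disjoint
    where
    size : ∀ v → ∣ extend v ∣ ≡ r
    size (pv j)     = ∣c∣ j
    size (av i a j) = interior-size (arc-walk i a) j
    disjoint : ∀ u v → Edge graph u v → extend u ∩ extend v ≡ ∅
    disjoint u v (inj₁ uv) = extend-adj uv
    disjoint u v (inj₂ vu) = trans (∩-comm (extend u) (extend v)) (extend-adj vu)

-- The bounds on |A ∩ B| over ℕ

ℤ-≤⇒ℕ-≤ : ∀ {x y : ℤ} z {a b} → x ≤ℤ y → x +ℤ z ≡ + a → y +ℤ z ≡ + b → a ≤ b
ℤ-≤⇒ℕ-≤ z x≤y x+z≡a y+z≡b = ℤ.drop‿+≤+ (subst₂ _≤ℤ_ x+z≡a y+z≡b (ℤ.+-monoˡ-≤ z x≤y))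

-1^even : ∀ u → (- + 1) ^ (u + u) ≡ + 1
-1^even zero    = refl
-1^even (suc u) rewrite +-suc u u | -1^even u = refl

-1^odd : ∀ u → (- + 1) ^ suc (u + u) ≡ - + 1
-1^odd u rewrite -1^even u = refl

pos-double : ∀ n → + (n + n) ≡ + n +ℤ + n
pos-double n = ℤ.pos-+ n n

pos-1+double : ∀ n → + suc (n + n) ≡ + 1 +ℤ (+ n +ℤ + n)
pos-1+double n = trans (ℤ.pos-+ 1 (n + n)) (cong (+ 1 +ℤ_) (pos-double n))

pos-4*-+ : ∀ a b → + 4 *ℤ + a +ℤ + 4 *ℤ + b ≡ + (4 * (a + b))
pos-4*-+ a b = sym (trans (cong +_ (*-distribˡ-+ 4 a b))
                 (trans (ℤ.pos-+ (4 * a) (4 * b)) (cong₂ _+ℤ_ (ℤ.pos-* 4 a) (ℤ.pos-* 4 b))))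

-- The cast terms are abstracted to variables with defining equations so that the ring solver applies.
lower-identity-even : ∀ (K T P R U : ℤ) → K ≡ + 1 +ℤ (R +ℤ R) → T ≡ U +ℤ U → P ≡ + 1 →
  (+ 2 *ℤ (K -ℤ T)) -ℤ (P +ℤ + 1) +ℤ + 4 *ℤ U ≡ + 4 *ℤ R
lower-identity-even _ _ _ R U refl refl refl = identity R U
  where
  identity : ∀ R U → (+ 2 *ℤ ((+ 1 +ℤ (R +ℤ R)) -ℤ (U +ℤ U))) -ℤ (+ 1 +ℤ + 1) +ℤ + 4 *ℤ U ≡ + 4 *ℤ R
  identity = ℤ-Ring.solve-∀

lower-identity-odd : ∀ (K T P R U : ℤ) → K ≡ + 1 +ℤ (R +ℤ R) → T ≡ + 1 +ℤ (U +ℤ U) → P ≡ - + 1 →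
  (+ 2 *ℤ (K -ℤ T)) -ℤ (P +ℤ + 1) +ℤ + 4 *ℤ U ≡ + 4 *ℤ R
lower-identity-odd _ _ _ R U refl refl refl = identity R U
  where
  identity : ∀ R U → (+ 2 *ℤ ((+ 1 +ℤ (R +ℤ R)) -ℤ (+ 1 +ℤ (U +ℤ U)))) -ℤ (- + 1 +ℤ + 1) +ℤ + 4 *ℤ U ≡ + 4 *ℤ R
  identity = ℤ-Ring.solve-∀

upper-identity-even : ∀ (T P U : ℤ) → T ≡ U +ℤ U → P ≡ + 1 → (+ 2 *ℤ (T -ℤ + 1)) -ℤ (P +ℤ + 1) +ℤ + 4 ≡ + 4 *ℤ U
upper-identity-even _ _ U refl refl = identity U
  where
  identity : ∀ U → (+ 2 *ℤ ((U +ℤ U) -ℤ + 1)) -ℤ (+ 1 +ℤ + 1) +ℤ + 4 ≡ + 4 *ℤ U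
  identity = ℤ-Ring.solve-∀

upper-identity-odd : ∀ (T P U : ℤ) → T ≡ + 1 +ℤ (U +ℤ U) → P ≡ - + 1 → (+ 2 *ℤ (T -ℤ + 1)) -ℤ (P +ℤ + 1) +ℤ + 0 ≡ + 4 *ℤ U
upper-identity-odd _ _ U refl refl = identity U
  where
  identity : ∀ U → (+ 2 *ℤ ((+ 1 +ℤ (U +ℤ U)) -ℤ + 1)) -ℤ (- + 1 +ℤ + 1) +ℤ + 0 ≡ + 4 *ℤ U
  identity = ℤ-Ring.solve-∀

lower-bound : ∀ r s t → (+ 2 *ℤ (+ suc (r + r) -ℤ + t)) -ℤ (((- + 1) ^ t) +ℤ + 1) ≤ℤ + 4 *ℤ + s →
  r + r ≤ s + s + t
lower-bound r s t H with parity t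
... | even u = subst (r + r ≤_) (regroup s u) (+-mono-≤ r≤s+u r≤s+u)
  where
  regroup : ∀ s u → (s + u) + (s + u) ≡ s + s + (u + u)
  regroup = solve-∀
  r≤s+u : r ≤ s + u
  r≤s+u = *-cancelˡ-≤ 4 (ℤ-≤⇒ℕ-≤ (+ 4 *ℤ + u) H
            (trans (lower-identity-even _ _ _ (+ r) (+ u) (pos-1+double r) (pos-double u) (-1^even u)) (sym (ℤ.pos-* 4 r)))
            (pos-4*-+ s u))
... | odd u = subst (r + r ≤_) (regroup s u) (m≤n⇒m≤1+n (+-mono-≤ r≤s+u r≤s+u))
  where
  regroup : ∀ s u → suc ((s + u) + (s + u)) ≡ s + s + suc (u + u)
  regroup = solve-∀
  r≤s+u : r ≤ s + u
  r≤s+u = *-cancelˡ-≤ 4 (ℤ-≤⇒ℕ-≤ (+ 4 *ℤ + u) H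
            (trans (lower-identity-odd _ _ _ (+ r) (+ u) (pos-1+double r) (pos-1+double u) (-1^odd u)) (sym (ℤ.pos-* 4 r)))
            (pos-4*-+ s u))

upper-bound : ∀ s t → + 4 *ℤ + s ≤ℤ (+ 2 *ℤ (+ t -ℤ + 1)) -ℤ (((- + 1) ^ t) +ℤ + 1) → suc (s + s) ≤ t
upper-bound s t H with parity t
... | even u = ≤-trans (s≤s (+-monoʳ-≤ s (n≤1+n s))) (+-mono-≤ 1+s≤u 1+s≤u)
  where
  1+s≤u : suc s ≤ u
  1+s≤u = *-cancelˡ-≤ 4 (ℤ-≤⇒ℕ-≤ (+ 4) H
            (trans (pos-4*-+ s 1) (cong (λ n → + (4 * n)) (+-comm s 1)))
            (trans (upper-identity-even _ _ (+ u) (pos-double u) (-1^even u)) (sym (ℤ.pos-* 4 u))))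
... | odd u = s≤s (+-mono-≤ s≤u s≤u)
  where
  s≤u : s ≤ u
  s≤u = *-cancelˡ-≤ 4 (ℤ-≤⇒ℕ-≤ (+ 0) H
          (trans (ℤ.+-identityʳ _) (sym (ℤ.pos-* 4 s)))
          (trans (upper-identity-odd _ _ (+ u) (pos-1+double u) (-1^odd u)) (sym (ℤ.pos-* 4 u))))

colour-necklace : ∀ r → 1 ≤ r → ∀ m (segs : Fin m → Seg (suc (r + r))) t →
  Dist (Necklace.graph (suc (r + r)) m segs) (Necklace.x (suc (r + r)) m segs) (Necklace.y (suc (r + r)) m segs) t →
  (A B : Subset (suc (r + r))) → ∣ A ∣ ≡ r → ∣ B ∣ ≡ r →
  r + r ≤ ∣ A ∩ B ∣ + ∣ A ∩ B ∣ + t → suc (∣ A ∩ B ∣ + ∣ A ∩ B ∣) ≤ t →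
  ∃ λ (φ : Necklace.NV (suc (r + r)) m segs → Subset (suc (r + r))) →
    IsFracColoring (Necklace.graph (suc (r + r)) m segs) (suc (r + r)) r φ ×
    φ (Necklace.x (suc (r + r)) m segs) ≡ A × φ (Necklace.y (suc (r + r)) m segs) ≡ B
colour-necklace r 1≤r m segs t (_ , shortest) A B ∣A∣ ∣B∣ lower upper =
  let h , wh , R = initial-reach (RSets.s≤r A B ∣A∣ ∣B∣ refl) (≤-trans lower (+-monoʳ-≤ _ t≤T)) (≤-trans upper t≤T)
      c , c₀≡A , cₘ≡B , ∣c∣ , ∣c∩c∣ =
        colour-path m l (λ i → SegmentProfile.α (prof i)) (λ i → SegmentProfile.best≤r (prof i))
                    (λ i → SegmentProfile.walkLength (prof i) (best i)) A B ∣A∣ ∣B∣ refl wh R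
  in extend segs prof c ∣c∣ ∣c∩c∣ , extend-colouring segs prof c ∣c∣ ∣c∩c∣ , c₀≡A , cₘ≡B
  where
  prof : ∀ i → SegmentProfile r (segs i)
  prof i = segmentProfile 1≤r (segs i)
  best : ∀ i → Arc (segs i)
  best i = SegmentProfile.best (prof i)
  l : Fin m → ℕ
  l i = suc (inner (segs i) (best i))
  t≤T : t ≤ foldr _+_ 0 l
  t≤T = shortest _ (best-walk m segs best)

odd-decomposition : ∀ k → k % 2 ≡ 1 → k ≡ suc ((k ∸ 1) / 2 + (k ∸ 1) / 2)
odd-decomposition k k%2≡1 = trans k≡1+q*2 (cong suc (trans (double (k / 2)) (cong (λ q → q + q) (sym k∸1/2≡q))))
  where
  double : ∀ q → q * 2 ≡ q + q
  double = solve-∀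
  k≡1+q*2 : k ≡ suc (k / 2 * 2)
  k≡1+q*2 = trans (m≡m%n+[m/n]*n k 2) (cong (_+ k / 2 * 2) k%2≡1)
  k∸1/2≡q : (k ∸ 1) / 2 ≡ k / 2
  k∸1/2≡q = trans (cong (λ n → (n ∸ 1) / 2) k≡1+q*2) (m*n/n≡m (k / 2) 2)

5≤1+r+r⇒1≤r : ∀ {r} → 5 ≤ suc (r + r) → 1 ≤ r
5≤1+r+r⇒1≤r {zero}  (s≤s ())
5≤1+r+r⇒1≤r {suc r} _ = s≤s z≤n

lemma4p5 : (k : ℕ) → 5 ≤ k → k % 2 ≡ 1 →
    (m : ℕ) (segs : Fin m → Seg k) (t : ℕ) →
    Dist (Necklace.graph k m segs) (Necklace.x k m segs) (Necklace.y k m segs) t →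
    (k Data.Nat.+ 1) / 2 ≤ t →
    (A B : Subset k) → ∣ A ∣ ≡ (k ∸ 1) / 2 → ∣ B ∣ ≡ (k ∸ 1) / 2 →
    -- (k-t)/2 - ((-1)^t+1)/4 ≤ |A ∩ B| ≤ (t-1)/2 - ((-1)^t+1)/4, multiplied by 4
    (+ 2 *ℤ (+ k -ℤ + t)) -ℤ (((- + 1) ^ t) +ℤ + 1) ≤ℤ + 4 *ℤ + ∣ A ∩ B ∣ →
    + 4 *ℤ + ∣ A ∩ B ∣ ≤ℤ (+ 2 *ℤ (+ t -ℤ + 1)) -ℤ (((- + 1) ^ t) +ℤ + 1) →
    Σ (Necklace.NV k m segs → Subset k) λ φ →
      IsFracColoring (Necklace.graph k m segs) k ((k ∸ 1) / 2) φ ×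
      φ (Necklace.x k m segs) ≡ A × φ (Necklace.y k m segs) ≡ B
lemma4p5 k 5≤k k%2≡1 m segs t dist _ A B ∣A∣ ∣B∣ lower upper with (k ∸ 1) / 2 | odd-decomposition k k%2≡1
... | r | refl = colour-necklace r (5≤1+r+r⇒1≤r 5≤k) m segs t dist A B ∣A∣ ∣B∣
                   (lower-bound r ∣ A ∩ B ∣ t lower) (upper-bound ∣ A ∩ B ∣ t upper)
-- The discarded hypothesis (k + 1) / 2 ≤ t follows from the two bounds on ∣ A ∩ B ∣.
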